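{- Let $G$ be a connected chordal graph, $K^\star$ a maximal clique of $G$, and consider the layer structure of $C(G)$ rooted by $K^\star$. Let $U\neq U'$ be two adjacent units in the same layer $\mathcal{L}_i$ (i.e., in the same bag), and let $\hat U$ be their common parent. Then for every edge $KK'$ of $C(G)$ with $K\in\mathcal{K}(U)$ and $K'\in\mathcal{K}(U')$, there exists $\hat K\in\mathcal{K}(\hat U)$ that is adjacent in $C(G)$ to both $K$ and $K'$.
   Context: Graphs are finite, simple, undirected; chordal means no induced cycle of length greater than three. A $u$-$v$ separator of $G$ is a set $X\subseteq V(G)$ with $u,v$ in different components of $G-X$; it is minimal if no proper subset is one. The clique graph $C(G)$ has as nodes the maximal cliques of $G$; distinct nodes $K,K'$ are adjacent iff $K\cap K'$ is a minimal $u$-$v$ separator of $G$ for all $u\in K\setminus K'$, $v\in K'\setminus K$; edge $KK'$ has label $K\cap K'$ and weight $|K\cap K'|$. Units are the connected components of $C(G)$ after deleting all edges of minimum weight; $\mathcal{K}(U)$ is the set of nodes of unit $U$. An edge of $C(G)$ crosses units $U,U'$ if its endpoints lie one in each. The layer structure of $C(G)$ rooted by $K^\star$ is the graph whose vertices are the units, with $U,U'$ adjacent iff some edge of $C(G)$ crosses them. The root is the unit containing $K^\star$; $\mathcal{L}_i$ is the set of units at distance $i$ from the root. Every unit $W\in\mathcal{L}_i$, $i\ge1$, is adjacent to exactly one unit of $\mathcal{L}_{i-1}$, its parent; two adjacent units in the same layer have the same parent. A bag is a set of units of one layer any two of which are adjacent (units of a layer are grouped into bags according to adjacency). -}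

module Defs where

open import Data.Nat using (ℕ; zero; suc; _+_; _≤_; _<_)
open import Data.Nat.DivMod using (_%_)
open import Data.Bool using (Bool; true; false)
open import Data.Fin using (Fin; toℕ)
open import Data.Fin.Subset using (Subset; _∈_; _∉_; _⊆_; _⊂_; _∩_; ∣_∣)
open import Data.Product using (Σ; ∃; ∃-syntax; _×_; _,_)
open import Data.Sum using (_⊎_)
open import Relation.Nullary using (¬_)
open import Relation.Binary.PropositionalEquality using (_≡_; _≢_)
open import Function.Definitions using (Injective)
open import Function.Bundles using (_⇔_)

record Graph (n : ℕ) : Set where
  field
    adj    : Fin n → Fin n → Bool
    sym    : ∀ u v → adj u v ≡ adj v u
    irrefl : ∀ u → adj u u ≡ false

open Graph public

module _ {n : ℕ} (G : Graph n) where

  Adjacent : Fin n → Fin n → Set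
  Adjacent u v = adj G u v ≡ true

  data WalkAvoiding (X : Subset n) : Fin n → Fin n → Set where
    here : ∀ {u} → u ∉ X → WalkAvoiding X u u
    step : ∀ {u w v} → u ∉ X → Adjacent u w → WalkAvoiding X w v →
           WalkAvoiding X u v

  Connected : Set
  Connected = ∀ u v → WalkAvoiding (Data.Fin.Subset.⊥) u v

  Separator : Subset n → Fin n → Fin n → Set
  Separator X u v = u ∉ X × v ∉ X × ¬ WalkAvoiding X u v

  MinimalSeparator : Subset n → Fin n → Fin n → Set
  MinimalSeparator X u v =
    Separator X u v × (∀ Y → Y ⊂ X → ¬ Separator Y u v)

  -- chordal: no induced cycle of length L = m + 4 ≥ 4
  -- (a cycle of length L is an injective map f : Fin L → Fin n; it is induced iff
  --  f i, f j adjacent exactly when i, j are cyclically consecutive)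
  Consecutive : ∀ {L} → Fin (suc L) → Fin (suc L) → Set
  Consecutive {L} i j =
    toℕ j ≡ suc (toℕ i) % suc L ⊎ toℕ i ≡ suc (toℕ j) % suc L

  Chordal : Set
  Chordal = ∀ (m : ℕ) (f : Fin (suc (suc (suc (suc m)))) → Fin n) →
    Injective _≡_ _≡_ f →
    ¬ (∀ i j → Adjacent (f i) (f j) ⇔ Consecutive i j)

  Clique : Subset n → Set
  Clique K = ∀ {u v} → u ∈ K → v ∈ K → u ≢ v → Adjacent u v

  MaxClique : Subset n → Set
  MaxClique K = Clique K × (∀ K' → Clique K' → K ⊆ K' → K' ⊆ K)

  CEdge : Subset n → Subset n → Set
  CEdge K K' = MaxClique K × MaxClique K' × K ≢ K' ×
    (∀ u v → u ∈ K → u ∉ K' → v ∈ K' → v ∉ K → MinimalSeparator (K ∩ K') u v)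

  weight : Subset n → Subset n → ℕ
  weight K K' = ∣ K ∩ K' ∣

  MinWeightEdge : Subset n → Subset n → Set
  MinWeightEdge K K' =
    CEdge K K' × (∀ L L' → CEdge L L' → weight K K' ≤ weight L L')

  HeavyEdge : Subset n → Subset n → Set
  HeavyEdge K K' = CEdge K K' × ¬ MinWeightEdge K K'

  -- K and L lie in the same unit (connected component of C(G) minus the
  -- minimum-weight edges). A unit U is represented by any of its nodes;
  -- K ∈ 𝒦(U) for U represented by A is  SameUnit A K.
  data SameUnit : Subset n → Subset n → Set where
    same : ∀ {K} → MaxClique K → SameUnit K K
    via  : ∀ {K L M} → HeavyEdge K L → SameUnit L M → SameUnit K M

  UnitAdj : Subset n → Subset n → Set
  UnitAdj A B = ¬ SameUnit A B ×
    (∃[ K ] ∃[ L ] (SameUnit A K × SameUnit B L × CEdge K L))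

  data UnitWalk : Subset n → Subset n → ℕ → Set where
    here : ∀ {A B} → SameUnit A B → UnitWalk A B zero
    step : ∀ {A C B k} → UnitAdj A C → UnitWalk C B k → UnitWalk A B (suc k)

  UnitDist : Subset n → Subset n → ℕ → Set
  UnitDist A B d = UnitWalk A B d × (∀ k → UnitWalk A B k → d ≤ k)

  InLayer : Subset n → ℕ → Subset n → Set
  InLayer Kstar i U = UnitDist Kstar U i

-- Let S = K ∩ K′. Since U ≠ U′, the edge KK′ has minimum weight, and so do the crossing
-- edges X₁H₁ (from U to Û) and X₂H₂ (from U′ to Û). Every edge inside a unit is heavier
-- than |S|, so its label has a vertex outside S, and in G − S reachability from a vertex
-- to a node of a unit does not depend on the node chosen. The heart of the proof is that
-- no vertex of K − S reaches Û in G − S: otherwise X₂ ∩ H₂ = S (else K − S would reach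
-- K′ − S), so S ⊆ H₂; and S ⊈ X₁ ∩ H₁ (else X₁ ∩ H₁ = S would not separate X₁ from H₁),
-- so some s ∈ S − X₁ ∩ H₁ lies in K and in H₂ and joins X₁ to H₁ in G − X₁ ∩ H₁.
-- Consequently X₁ ∩ H₁ = S. Symmetrically no vertex of K′ − S reaches Û, so S separates H₁
-- from K and from K′; each side lies in full components of G − S, so S is a minimal
-- separator between them and H₁ is adjacent to both K and K′ in C(G).
module Submission where

open import Defs
open import Data.Nat using (ℕ; suc; _≤_; _<_)
open import Data.Fin.Subset using (Subset; _∈_; _∉_; _⊆_; _⊈_; _⊂_; _∩_; _─_; ⁅_⁆; ∣_∣)
open import Data.Product using (∃-syntax; _×_; _,_; proj₁; proj₂)
open import Relation.Nullary using (¬_; yes; no)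
open import Data.Nat.Properties using (<⇒≱; ≮⇒≥; ≤-trans; _≤?_; _<?_)
open import Data.Fin using (Fin; _≟_)
open import Data.Fin.Properties using (¬∀⟶∃¬)
open import Data.Fin.Subset.Properties
  using (_∈?_; p⊂q⇒∣p∣<∣q∣; p⊆q⇒∣p∣≤∣q∣; p∩q⊆p; p∩q⊆q; x∈p∩q⁺; ∩-comm; ⊆-antisym;
         x∈⁅x⁆; x≢y⇒x∉⁅y⁆; x∈p∧x∉q⇒x∈p─q; p─q⊆p; p∩q≢∅⇒p─q⊂p)
open import Data.Sum using (_⊎_; inj₁; inj₂)
open import Data.Empty using (⊥-elim)
open import Function using (_∘_; const)
open import Relation.Nullary.Decidable using (decidable-stable; _→-dec_)
open import Relation.Binary.PropositionalEquality
  using (_≡_; _≢_; refl; trans; subst; cong; ≢-sym) renaming (sym to ≡-sym)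

module _ {n : ℕ} where

  ⊈-witness : {p q : Subset n} → p ⊈ q → ∃[ x ] (x ∈ p × x ∉ q)
  ⊈-witness {p} {q} p⊈q
    with ¬∀⟶∃¬ n (λ x → x ∈ p → x ∈ q) (λ x → x ∈? p →-dec x ∈? q) (λ f → p⊈q (f _))
  ... | x , x∈p↛x∈q =
    x , decidable-stable (x ∈? p) (λ x∉p → x∈p↛x∈q (⊥-elim ∘ x∉p)) , x∈p↛x∈q ∘ const

  p⊆q∧∣q∣≤∣p∣⇒q⊆p : {p q : Subset n} → p ⊆ q → ∣ q ∣ ≤ ∣ p ∣ → q ⊆ p
  p⊆q∧∣q∣≤∣p∣⇒q⊆p {p} p⊆q ∣q∣≤∣p∣ {x} x∈q = decidable-stable (x ∈? p) λ x∉p →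
    <⇒≱ (p⊂q⇒∣p∣<∣q∣ (p⊆q , x , x∈q , x∉p)) ∣q∣≤∣p∣

  x∉p─⁅y⁆∧x≢y⇒x∉p : {p : Subset n} {x y : Fin n} → x ∉ p ─ ⁅ y ⁆ → x ≢ y → x ∉ p
  x∉p─⁅y⁆∧x≢y⇒x∉p x∉p─y x≢y x∈p = x∉p─y (x∈p∧x∉q⇒x∈p─q x∈p (x≢y⇒x∉⁅y⁆ x≢y))

  q⊆p∧y∉q⇒q⊆p─⁅y⁆ : {p q : Subset n} {y : Fin n} → q ⊆ p → y ∉ q → q ⊆ p ─ ⁅ y ⁆
  q⊆p∧y∉q⇒q⊆p─⁅y⁆ {y = y} q⊆p y∉q x∈q =
    x∈p∧x∉q⇒x∈p─q (q⊆p x∈q) (x≢y⇒x∉⁅y⁆ λ { refl → y∉q x∈q })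

  x∈p⇒p─⁅x⁆⊂p : {p : Subset n} {x : Fin n} → x ∈ p → p ─ ⁅ x ⁆ ⊂ p
  x∈p⇒p─⁅x⁆⊂p {p} {x} x∈p = p∩q≢∅⇒p─q⊂p p ⁅ x ⁆ (x , x∈p∩q⁺ (x∈p , x∈⁅x⁆ x))

module CliqueGraph {n : ℕ} (G : Graph n) where

  private
    variable
      X Y Z P Q A B L L′ : Subset n
      a b u v w : Fin n

  Walk : Subset n → Fin n → Fin n → Set
  Walk = WalkAvoiding G

  source∉ : Walk X u v → u ∉ X
  source∉ (here u∉X)     = u∉X
  source∉ (step u∉X _ _) = u∉X

  target∉ : Walk X u v → v ∉ X
  target∉ (here v∉X)   = v∉X
  target∉ (step _ _ r) = target∉ r

  _++ʷ_ : Walk X u v → Walk X v w → Walk X u w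
  here _       ++ʷ q = q
  step p uv r ++ʷ q = step p uv (r ++ʷ q)

  Adjacent-sym : Adjacent G u v → Adjacent G v u
  Adjacent-sym {u = u} {v = v} uv = trans (sym G v u) uv

  reverse : Walk X u v → Walk X v u
  reverse (here u∉X)      = here u∉X
  reverse (step u∉X uw r) = reverse r ++ʷ step (source∉ r) (Adjacent-sym uw) (here u∉X)

  weaken : Y ⊆ X → Walk X u v → Walk Y u v
  weaken Y⊆X (here u∉X)      = here (u∉X ∘ Y⊆X)
  weaken Y⊆X (step u∉X uw r) = step (u∉X ∘ Y⊆X) uw (weaken Y⊆X r)

  Reaches : Subset n → Fin n → Subset n → Set
  Reaches X a P = ∃[ w ] (w ∈ P × Walk X a w)

  reaches-self : a ∈ P → a ∉ X → Reaches X a P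
  reaches-self {a = a} a∈P a∉X = a , a∈P , here a∉X

  reaches-weaken : Y ⊆ X → Reaches X a P → Reaches Y a P
  reaches-weaken Y⊆X (w , w∈P , r) = w , w∈P , weaken Y⊆X r

  reaches-prepend : Walk X a b → Reaches X b P → Reaches X a P
  reaches-prepend r (w , w∈P , q) = w , w∈P , r ++ʷ q

  reaches-clique : Clique G P → Reaches X a P → v ∈ P → v ∉ X → Walk X a v
  reaches-clique {v = v} P-clique (w , w∈P , r) v∈P v∉X with w ≟ v
  ... | yes refl = r
  ... | no w≢v   = r ++ʷ step (target∉ r) (P-clique w∈P v∈P w≢v) (here v∉X)

  MinimalSeparator-sym : MinimalSeparator G X u v → MinimalSeparator G X v u
  MinimalSeparator-sym ((u∉X , v∉X , ¬uv) , minimal) =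
    (v∉X , u∉X , ¬uv ∘ reverse) ,
    λ { Y Y⊂X (v∉Y , u∉Y , ¬vu) → minimal Y Y⊂X (u∉Y , v∉Y , ¬vu ∘ reverse) }

  avoids-or-reaches : ∀ s → Walk (Z ─ ⁅ s ⁆) a b → Walk Z a b ⊎ Walk (Z ─ ⁅ s ⁆) a s
  avoids-or-reaches {a = a} s r with a ≟ s
  avoids-or-reaches s (here a∉) | yes refl = inj₂ (here a∉)
  avoids-or-reaches s (step a∉ _ _) | yes refl = inj₂ (here a∉)
  avoids-or-reaches s (here a∉) | no a≢s = inj₁ (here (x∉p─⁅y⁆∧x≢y⇒x∉p a∉ a≢s))
  avoids-or-reaches s (step a∉ aw r) | no a≢s with avoids-or-reaches s r
  ... | inj₁ q = inj₁ (step (x∉p─⁅y⁆∧x≢y⇒x∉p a∉ a≢s) aw q)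
  ... | inj₂ q = inj₂ (step a∉ aw q)

  -- Minimality: without such a walk, Z − {s} would already separate a from b.
  MinimalSeparator-reaches : ∀ {s} → MinimalSeparator G Z a b → s ∈ Z →
                             ¬ ¬ Walk (Z ─ ⁅ s ⁆) a s
  MinimalSeparator-reaches {Z = Z} {a = a} {b = b} {s = s} ((a∉Z , b∉Z , ¬ab) , minimal) s∈Z ¬as =
    minimal (Z ─ ⁅ s ⁆) (x∈p⇒p─⁅x⁆⊂p s∈Z)
      (a∉Z ∘ p─q⊆p Z ⁅ s ⁆ , b∉Z ∘ p─q⊆p Z ⁅ s ⁆ , separated ∘ avoids-or-reaches s)
    where
    separated : ¬ (Walk Z a b ⊎ Walk (Z ─ ⁅ s ⁆) a s)
    separated (inj₁ ab) = ¬ab ab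
    separated (inj₂ as) = ¬as as

  MaxClique-⊈ : MaxClique G P → MaxClique G Q → P ≢ Q → P ⊈ Q
  MaxClique-⊈ (P-clique , P-max) (Q-clique , _) P≢Q P⊆Q =
    P≢Q (⊆-antisym P⊆Q (P-max _ Q-clique P⊆Q))

  CEdge-sym : CEdge G P Q → CEdge G Q P
  CEdge-sym {P = P} {Q = Q} (mP , mQ , P≢Q , separates) =
    mQ , mP , ≢-sym P≢Q , λ u v u∈Q u∉P v∈P v∉Q →
      subst (λ Z → MinimalSeparator G Z u v) (∩-comm P Q)
        (MinimalSeparator-sym (separates v u v∈P v∉Q u∈Q u∉P))

  CEdge-separates : CEdge G P Q → Reaches (P ∩ Q) a P → ¬ Reaches (P ∩ Q) a Q
  CEdge-separates {P = P} {Q = Q} (_ , _ , _ , separates) (w , w∈P , aw) (w′ , w′∈Q , aw′) =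
    proj₂ (proj₂ (proj₁ (separates w w′ w∈P w∉Q w′∈Q w′∉P))) (reverse aw ++ʷ aw′)
    where
    w∉Q : w ∉ Q
    w∉Q = λ w∈Q → target∉ aw (x∈p∩q⁺ (w∈P , w∈Q))
    w′∉P : w′ ∉ P
    w′∉P = λ w′∈P → target∉ aw′ (x∈p∩q⁺ (w′∈P , w′∈Q))

  -- P − S lies in full components of G − S, i.e. components adjacent to every vertex of S.
  Full : Subset n → Subset n → Set
  Full S P = ∀ {u s} → u ∈ P → u ∉ S → s ∈ S → ¬ ¬ Walk (S ─ ⁅ s ⁆) u s

  CEdge-fullˡ : CEdge G P Q → Full (P ∩ Q) P
  CEdge-fullˡ (mP , mQ , P≢Q , separates) u∈P u∉S s∈S
    with ⊈-witness (MaxClique-⊈ mQ mP (≢-sym P≢Q))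
  ... | z , z∈Q , z∉P = MinimalSeparator-reaches
    (separates _ z u∈P (λ u∈Q → u∉S (x∈p∩q⁺ (u∈P , u∈Q))) z∈Q z∉P) s∈S

  CEdge-fullʳ : CEdge G P Q → Full (P ∩ Q) Q
  CEdge-fullʳ {P = P} {Q = Q} e = subst (λ S → Full S Q) (∩-comm Q P) (CEdge-fullˡ (CEdge-sym e))

  CEdge-intro : ∀ {S} → MaxClique G P → MaxClique G Q → P ≢ Q → S ⊆ P → S ⊆ Q →
    (∀ {u} → u ∈ Q → u ∉ S → ¬ Reaches S u P) → Full S P → Full S Q → CEdge G P Q
  CEdge-intro {P = P} {Q = Q} {S} mP mQ P≢Q S⊆P S⊆Q separated fullP fullQ =
    mP , mQ , P≢Q , λ u v u∈P u∉Q v∈Q v∉P →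
      subst (λ Z → MinimalSeparator G Z u v) (⊆-antisym S⊆P∩Q P∩Q⊆S)
        (minimalSeparator u∈P (u∉Q ∘ S⊆Q) v∈Q (v∉P ∘ S⊆P))
    where
    S⊆P∩Q : S ⊆ P ∩ Q
    S⊆P∩Q s∈S = x∈p∩q⁺ (S⊆P s∈S , S⊆Q s∈S)
    P∩Q⊆S : P ∩ Q ⊆ S
    P∩Q⊆S {x} x∈P∩Q = decidable-stable (x ∈? S) λ x∉S →
      separated (p∩q⊆q P Q x∈P∩Q) x∉S (reaches-self (p∩q⊆p P Q x∈P∩Q) x∉S)
    minimalSeparator : u ∈ P → u ∉ S → v ∈ Q → v ∉ S → MinimalSeparator G S u v
    minimalSeparator u∈P u∉S v∈Q v∉S =
      (u∉S , v∉S , λ uv → separated v∈Q v∉S (_ , u∈P , reverse uv)) ,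
      λ { Y (Y⊆S , s , s∈S , s∉Y) (_ , _ , ¬uv) →
            fullP u∈P u∉S s∈S λ us → fullQ v∈Q v∉S s∈S λ vs →
              ¬uv (weaken (q⊆p∧y∉q⇒q⊆p─⁅y⁆ Y⊆S s∉Y) (us ++ʷ reverse vs)) }

  HeavyEdge-sym : HeavyEdge G P Q → HeavyEdge G Q P
  HeavyEdge-sym {P = P} {Q = Q} (e , ¬minimum) = CEdge-sym e , λ (_ , minimum) →
    ¬minimum (e , λ L L′ e″ → subst (_≤ weight G L L′) (cong ∣_∣ (∩-comm Q P)) (minimum L L′ e″))

  SameUnit-trans : SameUnit G A B → SameUnit G B P → SameUnit G A P
  SameUnit-trans (same _)  BP = BP
  SameUnit-trans (via h r) BP = via h (SameUnit-trans r BP)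

  SameUnit-sym : SameUnit G A B → SameUnit G B A
  SameUnit-sym (same mA) = same mA
  SameUnit-sym (via h@((mA , _) , _) r) =
    SameUnit-trans (SameUnit-sym r) (via (HeavyEdge-sym h) (same mA))

  SameUnit-maxCliqueʳ : SameUnit G A B → MaxClique G B
  SameUnit-maxCliqueʳ (same mB)  = mB
  SameUnit-maxCliqueʳ (via _ r) = SameUnit-maxCliqueʳ r

  distinctUnits⇒≢ : ¬ SameUnit G A B → SameUnit G A P → SameUnit G B Q → P ≢ Q
  distinctUnits⇒≢ A≁B AP BQ refl = A≁B (SameUnit-trans AP (SameUnit-sym BQ))

  crossing⇒MinWeightEdge : ¬ SameUnit G A B → SameUnit G A P → SameUnit G B Q →
                           CEdge G P Q → MinWeightEdge G P Q
  crossing⇒MinWeightEdge {P = P} {Q = Q} A≁B AP BQ e = e , λ L L′ e′ →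
    decidable-stable (weight G P Q ≤? weight G L L′) λ ≰ →
      A≁B (SameUnit-trans AP (via (e , λ (_ , minimum) → ≰ (minimum L L′ e′)) (SameUnit-sym BQ)))

  MinWeightEdge-sym : MinWeightEdge G P Q → MinWeightEdge G Q P
  MinWeightEdge-sym {P = P} {Q = Q} (e , minimum) =
    CEdge-sym e ,
    subst (λ k → ∀ L L′ → CEdge G L L′ → k ≤ weight G L L′) (cong ∣_∣ (∩-comm P Q)) minimum

  MinWeightEdge<HeavyEdge : MinWeightEdge G P Q → HeavyEdge G L L′ → weight G P Q < weight G L L′
  MinWeightEdge<HeavyEdge (_ , minimum) (e , ¬minimum) =
    decidable-stable (_ <? _) λ ≮ → ¬minimum (e , λ M M′ e′ → ≤-trans (≮⇒≥ ≮) (minimum M M′ e′))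

  -- The label of a heavy edge has a vertex outside P ∩ Q, so a walk avoiding P ∩ Q
  -- can cross it.
  reaches-sameUnit : MinWeightEdge G P Q → SameUnit G A B →
                     Reaches (P ∩ Q) a A → Reaches (P ∩ Q) a B
  reaches-sameUnit m (same _) r = r
  reaches-sameUnit {P = P} {Q = Q} m (via {K} {L} h@(((K-clique , _) , _) , _) K~B) r
    with ⊈-witness {p = K ∩ L} {q = P ∩ Q} (<⇒≱ (MinWeightEdge<HeavyEdge m h) ∘ p⊆q⇒∣p∣≤∣q∣)
  ... | t , t∈K∩L , t∉S = reaches-sameUnit m K~B
    (t , p∩q⊆q K L t∈K∩L , reaches-clique K-clique r (p∩q⊆p K L t∈K∩L) t∉S)

  module _ {K K′ X₁ H₁ X₂ H₂ : Subset n}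
    (e : MinWeightEdge G K K′) (e₁ : MinWeightEdge G X₁ H₁) (e₂ : MinWeightEdge G X₂ H₂)
    (K~X₁ : SameUnit G K X₁) (K′~X₂ : SameUnit G K′ X₂) (H₁~H₂ : SameUnit G H₁ H₂) where

    private
      S T : Subset n
      S = K ∩ K′
      T = X₁ ∩ H₁

    commonUnit-unreachable : ∀ {H} → SameUnit G H H₁ → a ∈ K → a ∉ S → ¬ Reaches S a H
    commonUnit-unreachable {a = a} H~H₁ a∈K a∉S a⇝H = S∖T-empty (⊈-witness S⊈T)
      where
      a⇝K : Reaches S a K
      a⇝K = reaches-self a∈K a∉S
      a⇝H₁ : Reaches S a H₁
      a⇝H₁ = reaches-sameUnit e H~H₁ a⇝H
      a⇝H₂ : Reaches S a H₂
      a⇝H₂ = reaches-sameUnit e H₁~H₂ a⇝H₁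
      a⇝X₁ : Reaches S a X₁
      a⇝X₁ = reaches-sameUnit e K~X₁ a⇝K

      X₂∩H₂⊆S : X₂ ∩ H₂ ⊆ S
      X₂∩H₂⊆S {z} z∈X₂∩H₂ = decidable-stable (z ∈? S) λ z∉S →
        CEdge-separates (proj₁ e) a⇝K
          (reaches-prepend (reaches-clique H₂-clique a⇝H₂ (p∩q⊆q X₂ H₂ z∈X₂∩H₂) z∉S)
            (reaches-sameUnit e (SameUnit-sym K′~X₂) (reaches-self (p∩q⊆p X₂ H₂ z∈X₂∩H₂) z∉S)))
        where
        H₂-clique : Clique G H₂
        H₂-clique = proj₁ (SameUnit-maxCliqueʳ H₁~H₂)

      S⊆H₂ : S ⊆ H₂
      S⊆H₂ = p∩q⊆q X₂ H₂ ∘ p⊆q∧∣q∣≤∣p∣⇒q⊆p X₂∩H₂⊆S (proj₂ e X₂ H₂ (proj₁ e₂))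

      S⊈T : S ⊈ T
      S⊈T S⊆T = CEdge-separates (proj₁ e₁) (reaches-weaken T⊆S a⇝X₁) (reaches-weaken T⊆S a⇝H₁)
        where
        T⊆S : T ⊆ S
        T⊆S = p⊆q∧∣q∣≤∣p∣⇒q⊆p S⊆T (proj₂ e₁ K K′ (proj₁ e))

      S∖T-empty : ¬ (∃[ s ] (s ∈ S × s ∉ T))
      S∖T-empty (s , s∈S , s∉T) = CEdge-separates (proj₁ e₁)
        (reaches-sameUnit e₁ K~X₁ (reaches-self (p∩q⊆p K K′ s∈S) s∉T))
        (reaches-sameUnit e₁ (SameUnit-sym H₁~H₂) (reaches-self (S⊆H₂ s∈S) s∉T))

    crossingLabel≡ : X₁ ∩ H₁ ≡ K ∩ K′
    crossingLabel≡ = ⊆-antisym T⊆S (p⊆q∧∣q∣≤∣p∣⇒q⊆p T⊆S (proj₂ e X₁ H₁ (proj₁ e₁)))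
      where
      H₁-max : MaxClique G H₁
      H₁-max = SameUnit-maxCliqueʳ (SameUnit-sym H₁~H₂)

      T⊆S : T ⊆ S
      T⊆S {z} z∈T = decidable-stable (z ∈? S) λ z∉S →
        H₁-unreachable (reaches-sameUnit e (SameUnit-sym K~X₁) (reaches-self (p∩q⊆p X₁ H₁ z∈T) z∉S))
        where
        H₁-unreachable : ¬ Reaches S z K
        H₁-unreachable (w , w∈K , zw) =
          commonUnit-unreachable (same H₁-max) w∈K (target∉ zw) (z , p∩q⊆q X₁ H₁ z∈T , reverse zw)

  commonUnit-adjacent : ∀ {K K′ X₁ H₁ X₂ H₂} →
    MinWeightEdge G K K′ → MinWeightEdge G X₁ H₁ → MinWeightEdge G X₂ H₂ →
    SameUnit G K X₁ → SameUnit G K′ X₂ → SameUnit G H₁ H₂ → H₁ ≢ K → H₁ ≢ K′ →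
    CEdge G H₁ K × CEdge G H₁ K′
  commonUnit-adjacent {K} {K′} {X₁} {H₁} e e₁ e₂ K~X₁ K′~X₂ H₁~H₂ H₁≢K H₁≢K′ =
    CEdge-intro H₁-max K-max H₁≢K S⊆H₁ (p∩q⊆p K K′) K-unreachable H₁-full (CEdge-fullˡ (proj₁ e)) ,
    CEdge-intro H₁-max K′-max H₁≢K′ S⊆H₁ (p∩q⊆q K K′) K′-unreachable H₁-full (CEdge-fullʳ (proj₁ e))
    where
    H₁-max : MaxClique G H₁
    H₁-max = SameUnit-maxCliqueʳ (SameUnit-sym H₁~H₂)
    K-max : MaxClique G K
    K-max = SameUnit-maxCliqueʳ (SameUnit-sym K~X₁)
    K′-max : MaxClique G K′
    K′-max = SameUnit-maxCliqueʳ (SameUnit-sym K′~X₂)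
    label≡ : X₁ ∩ H₁ ≡ K ∩ K′
    label≡ = crossingLabel≡ e e₁ e₂ K~X₁ K′~X₂ H₁~H₂
    S⊆H₁ : K ∩ K′ ⊆ H₁
    S⊆H₁ {x} = p∩q⊆q X₁ H₁ ∘ subst (x ∈_) (≡-sym label≡)
    H₁-full : Full (K ∩ K′) H₁
    H₁-full = subst (λ S → Full S H₁) label≡ (CEdge-fullʳ (proj₁ e₁))
    K-unreachable : a ∈ K → a ∉ K ∩ K′ → ¬ Reaches (K ∩ K′) a H₁
    K-unreachable = commonUnit-unreachable e e₁ e₂ K~X₁ K′~X₂ H₁~H₂ (same H₁-max)
    K′-unreachable : a ∈ K′ → a ∉ K ∩ K′ → ¬ Reaches (K ∩ K′) a H₁
    K′-unreachable {a} a∈K′ a∉S = subst (λ S → ¬ Reaches S a H₁) (∩-comm K′ K)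
      (commonUnit-unreachable (MinWeightEdge-sym e) e₂ e₁ K′~X₂ K~X₁ (SameUnit-sym H₁~H₂) H₁~H₂
        a∈K′ (a∉S ∘ subst (a ∈_) (∩-comm K′ K)))

mainTheorem11 : ∀ {n : ℕ} (G : Graph n) → Connected G → Chordal G →
    (Kstar : Subset n) → MaxClique G Kstar →
    (U U′ Uhat : Subset n) (i : ℕ) →
    InLayer G Kstar (suc i) U → InLayer G Kstar (suc i) U′ →
    ¬ SameUnit G U U′ → UnitAdj G U U′ →
    InLayer G Kstar i Uhat → UnitAdj G U Uhat → UnitAdj G U′ Uhat →
    (K K′ : Subset n) → SameUnit G U K → SameUnit G U′ K′ → CEdge G K K′ →
    ∃[ Khat ] (SameUnit G Uhat Khat × CEdge G Khat K × CEdge G Khat K′)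
mainTheorem11 G _ _ _ _ U U′ Û _ _ _ U≁U′ _ _ (U≁Û , X₁ , H₁ , U~X₁ , Û~H₁ , c₁)
  (U′≁Û , X₂ , H₂ , U′~X₂ , Û~H₂ , c₂) K K′ U~K U′~K′ c =
  H₁ , Û~H₁ ,
  commonUnit-adjacent
    (crossing⇒MinWeightEdge U≁U′ U~K U′~K′ c)
    (crossing⇒MinWeightEdge U≁Û U~X₁ Û~H₁ c₁)
    (crossing⇒MinWeightEdge U′≁Û U′~X₂ Û~H₂ c₂)
    (SameUnit-trans (SameUnit-sym U~K) U~X₁)
    (SameUnit-trans (SameUnit-sym U′~K′) U′~X₂)
    (SameUnit-trans (SameUnit-sym Û~H₁) Û~H₂)
    (distinctUnits⇒≢ (U≁Û ∘ SameUnit-sym) Û~H₁ U~K)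
    (distinctUnits⇒≢ (U′≁Û ∘ SameUnit-sym) Û~H₁ U′~K′)
  where open CliqueGraph G
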